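{- For every integer $k\ge 2$, the class of finite simple graphs admitting a closed neighborhood balanced $k$-coloring is not hereditary; that is, there is a graph in this class having an induced subgraph not in this class.
   Context: $N[v]$ is the closed neighborhood of $v$. A closed neighborhood balanced $k$-coloring of a graph $G$ is a map $c:V(G)\to\{1,\dots,k\}$ such that for every vertex $v$ the numbers $|N[v]\cap c^{ -1}(i)|$, $i=1,\dots,k$, are all equal. A class of graphs is hereditary if it is closed under taking induced subgraphs. -}

module Defs where

open import Data.Nat using (ℕ; suc; _≤_)
open import Data.Bool using (Bool; true; false; _∨_; _∧_; if_then_else_)
open import Data.Fin using (Fin; _≟_)
open import Data.Vec.Functional using (foldr)
open import Data.Product using (Σ; ∃; _×_; _,_)
open import Relation.Nullary using (¬_)
open import Relation.Nullary.Decidable using (⌊_⌋)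
open import Relation.Binary.PropositionalEquality using (_≡_)
open import Function.Definitions using (Injective)

record Graph : Set where
  field
    n      : ℕ
    adj    : Fin n → Fin n → Bool
    sym    : ∀ u v → adj u v ≡ adj v u
    irrefl : ∀ v → adj v v ≡ false
open Graph public

countF : ∀ {m} → (Fin m → Bool) → ℕ
countF {m} p = foldr (λ b acc → if b then suc acc else acc) 0 p

inN : (G : Graph) → Fin (n G) → Fin (n G) → Bool
inN G v u = ⌊ u ≟ v ⌋ ∨ adj G v u

nbColorCount : (G : Graph) {k : ℕ} → (Fin (n G) → Fin k) → Fin (n G) → Fin k → ℕ
nbColorCount G c v i = countF (λ u → inN G v u ∧ ⌊ c u ≟ i ⌋)

-- closed neighbourhood balanced k-coloring (colors Fin k ≅ {1,…,k})
IsCNBColoring : (G : Graph) (k : ℕ) → (Fin (n G) → Fin k) → Set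
IsCNBColoring G k c = ∀ v i j → nbColorCount G c v i ≡ nbColorCount G c v j

HasCNBColoring : ℕ → Graph → Set
HasCNBColoring k G = Σ (Fin (n G) → Fin k) (IsCNBColoring G k)

IsInducedSubgraph : Graph → Graph → Set
IsInducedSubgraph H G =
  Σ (Fin (n H) → Fin (n G)) λ f →
    Injective _≡_ _≡_ f × (∀ u v → adj H u v ≡ adj G (f u) (f v))

-- The complete graph K_k is closed neighbourhood balanced under the coloring
-- that gives every vertex its own color, since every closed neighbourhood is
-- all of V(K_k). Its one-vertex induced subgraph is not: there the single
-- closed neighbourhood meets one color once and every other color not at all.
module Submission where

open import Defs hiding (sym)
open import Data.Nat using (ℕ; zero; suc; _≤_; s≤s; z≤n)
open import Data.Nat.Properties using (≤-trans; n≤1+n; 1+n≢0)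
open import Data.Bool using (Bool; true; false; not; _∨_; _∧_; if_then_else_)
open import Data.Bool.Properties using (∧-identityʳ; ∨-identityʳ; ∨-inverseʳ)
open import Data.Fin using (Fin; zero; suc; _≟_; inject≤; punchIn)
open import Data.Fin.Properties using (suc-injective; inject≤-injective; punchInᵢ≢i)
open import Data.Product using (Σ; _×_; _,_)
open import Function using (_∘_; id)
open import Function.Definitions using (Injective)
open import Relation.Nullary using (¬_; yes; no)
open import Relation.Nullary.Decidable using (⌊_⌋; isYes≗does; dec-true; dec-false)
open import Relation.Binary.PropositionalEquality
  using (_≡_; _≢_; refl; sym; trans; cong; module ≡-Reasoning)

countF-cong : ∀ {m} {p q : Fin m → Bool} → (∀ u → p u ≡ q u) → countF p ≡ countF q
countF-cong {zero}  _ = refl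
countF-cong {suc m} {p} {q} p≗q
  rewrite p≗q zero | countF-cong {m} {p ∘ suc} {q ∘ suc} (p≗q ∘ suc) = refl

countF-false : ∀ {m} → countF {m} (λ _ → false) ≡ 0
countF-false {zero}  = refl
countF-false {suc m} = countF-false {m}

⌊≟⌋-refl : ∀ {m} (v : Fin m) → ⌊ v ≟ v ⌋ ≡ true
⌊≟⌋-refl v = trans (isYes≗does (v ≟ v)) (dec-true (v ≟ v) refl)

≢⇒⌊≟⌋≡false : ∀ {m} {u v : Fin m} → u ≢ v → ⌊ u ≟ v ⌋ ≡ false
≢⇒⌊≟⌋≡false {u = u} {v} u≢v = trans (isYes≗does (u ≟ v)) (dec-false (u ≟ v) u≢v)

⌊≟⌋-sym : ∀ {m} (u v : Fin m) → ⌊ u ≟ v ⌋ ≡ ⌊ v ≟ u ⌋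
⌊≟⌋-sym u v with u ≟ v
... | yes refl = sym (⌊≟⌋-refl u)
... | no u≢v   = sym (≢⇒⌊≟⌋≡false (u≢v ∘ sym))

⌊≟⌋-injective : ∀ {m m′} {f : Fin m → Fin m′} → Injective _≡_ _≡_ f →
                ∀ u v → ⌊ f u ≟ f v ⌋ ≡ ⌊ u ≟ v ⌋
⌊≟⌋-injective {f = f} f-inj u v with u ≟ v
... | yes refl = ⌊≟⌋-refl (f u)
... | no u≢v   = ≢⇒⌊≟⌋≡false (u≢v ∘ f-inj)

countF-single : ∀ {m} (v : Fin m) (p : Fin m → Bool) →
                countF (λ u → ⌊ u ≟ v ⌋ ∧ p u) ≡ (if p v then 1 else 0)
countF-single {suc m} zero p with p zero
... | true  = cong suc (countF-false {m})
... | false = countF-false {m}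
countF-single {suc m} (suc v) p = trans
  (countF-cong {m} λ u → cong (_∧ p (suc u)) (⌊≟⌋-injective suc-injective u v))
  (countF-single v (p ∘ suc))

complete : ℕ → Graph
complete m = record
  { n      = m
  ; adj    = λ u v → not ⌊ u ≟ v ⌋
  ; sym    = λ u v → cong not (⌊≟⌋-sym u v)
  ; irrefl = λ v → cong not (⌊≟⌋-refl v)
  }

inN-complete : ∀ m (v u : Fin m) → inN (complete m) v u ≡ true
inN-complete m v u rewrite ⌊≟⌋-sym v u = ∨-inverseʳ ⌊ u ≟ v ⌋

complete-balanced : ∀ m → IsCNBColoring (complete m) m id
complete-balanced m v i j = trans (count-one i) (sym (count-one j))
  where
  count-one : ∀ i → nbColorCount (complete m) id v i ≡ 1
  count-one i = trans
    (countF-cong λ u → trans (cong (_∧ ⌊ u ≟ i ⌋) (inN-complete m v u))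
                             (sym (∧-identityʳ ⌊ u ≟ i ⌋)))
    (countF-single i (λ _ → true))

complete-induced : ∀ {m m′} → m ≤ m′ → IsInducedSubgraph (complete m) (complete m′)
complete-induced m≤m′ =
    (λ u → inject≤ u m≤m′)
  , (λ {u} {v} → inject≤-injective m≤m′ m≤m′ u v)
  , (λ u v → cong not (sym (⌊≟⌋-injective (inject≤-injective m≤m′ m≤m′ _ _) u v)))

isolated⇒¬CNBColoring : ∀ {k} (G : Graph) (v : Fin (n G)) →
                        (∀ u → adj G v u ≡ false) → 2 ≤ k → ¬ HasCNBColoring k G
isolated⇒¬CNBColoring {suc (suc _)} G v isolated (s≤s (s≤s z≤n)) (c , balanced) =
  1+n≢0 one≡zero
  where
  indicator : Bool → ℕ
  indicator b = if b then 1 else 0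

  count : ∀ i → nbColorCount G c v i ≡ indicator ⌊ c v ≟ i ⌋
  count i = trans
    (countF-cong λ u → cong (_∧ ⌊ c u ≟ i ⌋)
                            (trans (cong (⌊ u ≟ v ⌋ ∨_) (isolated u)) (∨-identityʳ _)))
    (countF-single v (λ u → ⌊ c u ≟ i ⌋))

  other : Fin _
  other = punchIn (c v) zero

  open ≡-Reasoning
  one≡zero : 1 ≡ 0
  one≡zero = begin
    1                              ≡⟨ cong indicator (⌊≟⌋-refl (c v)) ⟨
    indicator ⌊ c v ≟ c v ⌋        ≡⟨ count (c v) ⟨
    nbColorCount G c v (c v)       ≡⟨ balanced v (c v) other ⟩
    nbColorCount G c v other       ≡⟨ count other ⟩
    indicator ⌊ c v ≟ other ⌋      ≡⟨ cong indicator (≢⇒⌊≟⌋≡false (punchInᵢ≢i (c v) zero ∘ sym)) ⟩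
    0                              ∎

corollary2p7 : (k : ℕ) → 2 ≤ k →
    Σ Graph λ G → Σ Graph λ H →
      HasCNBColoring k G × IsInducedSubgraph H G × ¬ HasCNBColoring k H
corollary2p7 k 2≤k =
  complete k , complete 1 ,
  (id , complete-balanced k) ,
  complete-induced (≤-trans (n≤1+n 1) 2≤k) ,
  isolated⇒¬CNBColoring (complete 1) zero (λ { zero → refl }) 2≤k
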